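{- Let $m_1,m_2$ be positive integers, $\mathcal{K}=2\,\mathrm{lcm}(m_1,m_2)$, and let $P\in\mathcal{S}^2$ be such that no point $F^k(P)$, $k\in\mathbb{Z}$, is a corner of the rectangle $[0,m_1]\times[0,m_2]$ (i.e. $P$ lies on a closed path). Then the number of indices $k\in\{1,\dots,\mathcal{K}\}$ with $F^k(P)\in\overline{\mathcal{S}}^2$ equals \[B(m_1,m_2)=\frac{2(m_1+m_2)}{\gcd(m_1,m_2)}.\]
   Context: $\mathcal{S}^2=\{(x_1,x_2)\in\mathbb{Z}^2: 0\le x_i\le m_i,\ i=1,2\}$ and $\overline{\mathcal{S}}^2=\{(x_1,x_2)\in\mathcal{S}^2:\ x_i\in\{0,m_i\}\text{ for some } i\}$ is its set of boundary points. For a positive integer $m$ let $\varphi_m(u)=\min_{n\in\mathbb{Z}}|u-2nm|$ for $u\in\mathbb{Z}$. For $k\in\mathbb{Z}$ put $F^k(x_1,x_2)=(\varphi_{m_1}(x_1+k),\varphi_{m_2}(x_2+k))$ (the position after $k$ steps of a light beam started at $(x_1,x_2)$ in direction $(+1,+1)$ reflecting in the mirror boundary of $[0,m_1]\times[0,m_2]$). The closed path starting at $P$ consists of the points $F^1(P),\dots,F^{\mathcal{K}}(P)$, where $\mathcal{K}=2\,\mathrm{lcm}(m_1,m_2)$ is its step length; the boundary points it passes through (the reflections) are counted with multiplicity over these steps. -}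

module Defs where

open import Data.Nat using (ℕ; zero; suc; _+_; _*_; _∸_; _⊓_; _≤_; NonZero)
open import Data.Integer using (ℤ; +_; _%ℕ_)
import Data.Integer as ℤ
open import Data.Nat.LCM using (lcm)
open import Data.Product using (_×_; _,_)
open import Data.Sum using (_⊎_)
open import Data.Bool using (Bool; true; false; _∨_)
open import Data.List using (List; length; filter; map; upTo)
open import Relation.Binary.PropositionalEquality using (_≡_)
open import Relation.Nullary using (Dec; yes; no)
open import Data.Nat using (_≟_)
open import Relation.Nullary.Decidable using (_⊎-dec_)

-- φ_m(u) = min_{n ∈ ℤ} |u - 2nm|, for m ≥ 1.
-- Computed as min(r, 2m - r) with r = u mod 2m ∈ {0,…,2m-1}
-- (the nearest multiples of 2m to u are u - r and u - r + 2m).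
φ : (m : ℕ) → .{{NonZero m}} → ℤ → ℕ
φ m@(suc _) u = r ⊓ (2 * m ∸ r)
  where r = u %ℕ (2 * m)

Point : Set
Point = ℕ × ℕ

F : (m₁ m₂ : ℕ) → .{{NonZero m₁}} → .{{NonZero m₂}} → ℤ → Point → Point
F m₁ m₂ k (x₁ , x₂) = (φ m₁ (+ x₁ ℤ.+ k) , φ m₂ (+ x₂ ℤ.+ k))

InS : (m₁ m₂ : ℕ) → Point → Set
InS m₁ m₂ (x₁ , x₂) = x₁ ≤ m₁ × x₂ ≤ m₂

IsBoundary : (m₁ m₂ : ℕ) → Point → Set
IsBoundary m₁ m₂ (x₁ , x₂) = (x₁ ≡ 0 ⊎ x₁ ≡ m₁) ⊎ (x₂ ≡ 0 ⊎ x₂ ≡ m₂)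

isBoundary? : (m₁ m₂ : ℕ) → (p : Point) → Dec (IsBoundary m₁ m₂ p)
isBoundary? m₁ m₂ (x₁ , x₂) =
  ((x₁ ≟ 0) ⊎-dec (x₁ ≟ m₁)) ⊎-dec ((x₂ ≟ 0) ⊎-dec (x₂ ≟ m₂))

IsCorner : (m₁ m₂ : ℕ) → Point → Set
IsCorner m₁ m₂ (x₁ , x₂) = (x₁ ≡ 0 ⊎ x₁ ≡ m₁) × (x₂ ≡ 0 ⊎ x₂ ≡ m₂)

𝒦 : ℕ → ℕ → ℕ
𝒦 m₁ m₂ = 2 * lcm m₁ m₂

boundaryCount : (m₁ m₂ : ℕ) → .{{NonZero m₁}} → .{{NonZero m₂}} → Point → ℕ
boundaryCount m₁ m₂ P =
  length (filter (λ k → isBoundary? m₁ m₂ (F m₁ m₂ (+ k) P))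
                 (map suc (upTo (𝒦 m₁ m₂))))

open import Data.Nat using (_/_; ≢-nonZero)
open import Data.Nat.GCD using (gcd; gcd[m,n]≢0)
open import Data.Sum using (inj₁)

B : (m₁ m₂ : ℕ) → .{{NonZero m₁}} → ℕ
B m₁@(suc _) m₂ = _/_ (2 * (m₁ + m₂)) (gcd m₁ m₂)
  {{≢-nonZero (gcd[m,n]≢0 m₁ m₂ (inj₁ (λ ())))}}

{-# OPTIONS --safe #-}
-- The beam is on a vertical side at step k exactly when m₁ ∣ x₁ + k, and on a horizontal
-- side exactly when m₂ ∣ x₂ + k; avoiding corners means the two never happen together.
-- So the count is the number of multiples of m₁ among x₁+1, …, x₁+𝒦 plus that of m₂ among
-- x₂+1, …, x₂+𝒦, i.e. 𝒦/m₁ + 𝒦/m₂ = 2(m₁+m₂)/gcd(m₁,m₂), as both mᵢ divide 𝒦.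
module Submission where

open import Defs
open import Data.Nat using (ℕ; NonZero)
open import Data.Integer using (ℤ)
open import Relation.Nullary using (¬_)
open import Relation.Binary.PropositionalEquality using (_≡_)

open import Data.Nat using (zero; suc; _+_; _*_; _∸_; _⊓_; _<_; _/_; _%_; s≤s; z≤n; ≢-nonZero)
open import Data.Nat.Properties
open import Data.Nat.Divisibility
open import Data.Nat.DivMod
open import Data.Nat.GCD using (gcd; gcd[m,n]∣m; gcd[m,n]∣n; gcd[m,n]≢0)
open import Data.Nat.LCM using (m∣lcm[m,n]; n∣lcm[m,n])
open import Data.Nat.Solver using (module +-*-Solver)
import Data.Integer as ℤ
open import Data.List using ([]; _∷_; [_]; _++_; length; filter; map; upTo)
open import Data.List.Properties using (filter-++; length-++; map-++; upTo-∷ʳ)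
open import Data.Product using (_,_; proj₁; proj₂)
open import Data.Sum using (_⊎_; inj₁; inj₂)
open import Data.Empty using (⊥-elim)
import Data.Sum as Sum
open import Function using (_∘_)
open import Function.Bundles using (_⇔_; mk⇔; Equivalence)
open import Function.Construct.Composition using (_⇔-∘_)
open import Function.Construct.Symmetry using (⇔-sym)
open import Relation.Nullary using (yes; no; contradiction)
open import Relation.Unary using (Pred; Decidable; _≐_; _∪_; _∩_; Empty)
open import Relation.Binary.PropositionalEquality using (refl; sym; trans; cong; cong₂; subst; module ≡-Reasoning)

open +-*-Solver using (solve; _:+_; _:*_; _:=_; con)
open Equivalence using (to; from)
open ≡-Reasoning

module _ {a ℓ} {A : Set a} {P Q R : Pred A ℓ}
         (P? : Decidable P) (Q? : Decidable Q) (R? : Decidable R) where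

  length-filter-∪ : R ≐ P ∪ Q → Empty (P ∩ Q) → ∀ xs →
    length (filter R? xs) ≡ length (filter P? xs) + length (filter Q? xs)
  length-filter-∪ R≐P∪Q P∩Q≡∅ [] = refl
  length-filter-∪ R≐P∪Q P∩Q≡∅ (x ∷ xs) with R? x | P? x | Q? x
  ... | _     | yes p | yes q = contradiction (p , q) (P∩Q≡∅ x)
  ... | yes _ | yes _ | no _  = cong suc (length-filter-∪ R≐P∪Q P∩Q≡∅ xs)
  ... | yes _ | no _  | yes _ =
    trans (cong suc (length-filter-∪ R≐P∪Q P∩Q≡∅ xs)) (sym (+-suc _ _))
  ... | yes r | no ¬p | no ¬q = ⊥-elim (Sum.[ ¬p , ¬q ] (proj₁ R≐P∪Q r))
  ... | no ¬r | yes p | no _  = contradiction (proj₂ R≐P∪Q (inj₁ p)) ¬r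
  ... | no ¬r | no _  | yes q = contradiction (proj₂ R≐P∪Q (inj₂ q)) ¬r
  ... | no _  | no _  | no _  = length-filter-∪ R≐P∪Q P∩Q≡∅ xs

d∣1+n⇒[1+n]/d≡1+n/d : ∀ {d n} .{{_ : NonZero d}} → d ∣ suc n → suc n / d ≡ suc (n / d)
d∣1+n⇒[1+n]/d≡1+n/d {d@(suc d-1)} (divides-refl (suc q)) = sym (begin
  suc ((d-1 + q * d) / d)       ≡⟨ cong suc (+-distrib-/-∣ʳ d-1 (n∣m*n q)) ⟩
  suc (d-1 / d + q * d / d)     ≡⟨ cong suc (cong₂ _+_ (m<n⇒m/n≡0 (n<1+n d-1)) (m*n/n≡m q d)) ⟩
  suc q                         ≡⟨ sym (m*n/n≡m (suc q) d) ⟩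
  suc q * d / d                 ∎)

d∤1+n⇒[1+n]/d≡n/d : ∀ {d n} .{{_ : NonZero d}} → ¬ d ∣ suc n → suc n / d ≡ n / d
d∤1+n⇒[1+n]/d≡n/d {d} {n} d∤1+n with m≤n⇒m<n∨m≡n (m%n<n n d)
... | inj₂ 1+r≡d = contradiction (divides (suc (n / d)) 1+n≡[1+q]*d) d∤1+n
  where
  1+n≡[1+q]*d : suc n ≡ suc (n / d) * d
  1+n≡[1+q]*d = trans (cong suc (m≡m%n+[m/n]*n n d)) (cong (_+ n / d * d) 1+r≡d)
... | inj₁ 1+r<d = begin
  suc n / d                            ≡⟨ /-congˡ (cong suc (m≡m%n+[m/n]*n n d)) ⟩
  (suc (n % d) + n / d * d) / d        ≡⟨ +-distrib-/-∣ʳ (suc (n % d)) (n∣m*n (n / d)) ⟩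
  suc (n % d) / d + n / d * d / d      ≡⟨ cong₂ _+_ (m<n⇒m/n≡0 1+r<d) (m*n/n≡m (n / d) d) ⟩
  n / d                                ∎

countShiftedMultiples : ℕ → ℕ → ℕ → ℕ
countShiftedMultiples d x n = length (filter (λ k → d ∣? x + k) (map suc (upTo n)))

countShiftedMultiples-suc : ∀ d x n → countShiftedMultiples d x (suc n) ≡
  countShiftedMultiples d x n + length (filter (λ k → d ∣? x + k) [ suc n ])
countShiftedMultiples-suc d x n = begin
  length (filter D? (map suc (upTo (suc n))))
    ≡⟨ cong (length ∘ filter D? ∘ map suc) (sym (upTo-∷ʳ n)) ⟩
  length (filter D? (map suc (upTo n ++ [ n ])))
    ≡⟨ cong (length ∘ filter D?) (map-++ suc (upTo n) [ n ]) ⟩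
  length (filter D? (map suc (upTo n) ++ [ suc n ]))
    ≡⟨ cong length (filter-++ D? (map suc (upTo n)) [ suc n ]) ⟩
  length (filter D? (map suc (upTo n)) ++ filter D? [ suc n ])
    ≡⟨ length-++ (filter D? (map suc (upTo n))) ⟩
  countShiftedMultiples d x n + length (filter D? [ suc n ]) ∎
  where
  D? : Decidable (λ k → d ∣ x + k)
  D? k = d ∣? x + k

lastTerm+[x+n]/d≡[x+1+n]/d : ∀ d .{{_ : NonZero d}} x n →
  length (filter (λ k → d ∣? x + k) [ suc n ]) + (x + n) / d ≡ (x + suc n) / d
lastTerm+[x+n]/d≡[x+1+n]/d d x n rewrite +-suc x n with d ∣? suc (x + n)
... | yes d∣1+x+n = sym (d∣1+n⇒[1+n]/d≡1+n/d d∣1+x+n)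
... | no  d∤1+x+n = sym (d∤1+n⇒[1+n]/d≡n/d d∤1+x+n)

countShiftedMultiples+/≡/ : ∀ d .{{_ : NonZero d}} x n →
  countShiftedMultiples d x n + x / d ≡ (x + n) / d
countShiftedMultiples+/≡/ d x zero = cong (_/ d) (sym (+-identityʳ x))
countShiftedMultiples+/≡/ d x (suc n) = begin
  countShiftedMultiples d x (suc n) + x / d
    ≡⟨ cong (_+ x / d) (countShiftedMultiples-suc d x n) ⟩
  (countShiftedMultiples d x n + lastTerm) + x / d
    ≡⟨ solve 3 (λ c l q → (c :+ l) :+ q := l :+ (c :+ q)) refl (countShiftedMultiples d x n) lastTerm (x / d) ⟩
  lastTerm + (countShiftedMultiples d x n + x / d)
    ≡⟨ cong (lastTerm +_) (countShiftedMultiples+/≡/ d x n) ⟩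
  lastTerm + (x + n) / d
    ≡⟨ lastTerm+[x+n]/d≡[x+1+n]/d d x n ⟩
  (x + suc n) / d ∎
  where
  lastTerm : ℕ
  lastTerm = length (filter (λ k → d ∣? x + k) [ suc n ])

d∣n⇒countShiftedMultiples≡n/d : ∀ d .{{_ : NonZero d}} x {n} → d ∣ n → countShiftedMultiples d x n ≡ n / d
d∣n⇒countShiftedMultiples≡n/d d x {n} d∣n = +-cancelʳ-≡ (x / d) _ _ (begin
  countShiftedMultiples d x n + x / d ≡⟨ countShiftedMultiples+/≡/ d x n ⟩
  (x + n) / d                         ≡⟨ +-distrib-/-∣ʳ x d∣n ⟩
  x / d + n / d                       ≡⟨ +-comm (x / d) (n / d) ⟩
  n / d + x / d                       ∎)

[2*m]∸m≡m : ∀ m → 2 * m ∸ m ≡ m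
[2*m]∸m≡m m = trans (m+n∸m≡n m (m + 0)) (+-identityʳ m)

∣⇔≡0⊎≡ : ∀ {m r} → r < 2 * m → m ∣ r ⇔ (r ≡ 0 ⊎ r ≡ m)
∣⇔≡0⊎≡ {m} r<2m =
  mk⇔ (only0orm r<2m) Sum.[ (λ r≡0 → subst (m ∣_) (sym r≡0) (m ∣0)) , (λ r≡m → ∣-reflexive (sym r≡m)) ]
  where
  only0orm : ∀ {r} → r < 2 * m → m ∣ r → r ≡ 0 ⊎ r ≡ m
  only0orm _      (divides-refl 0) = inj₁ refl
  only0orm _      (divides-refl 1) = inj₂ (*-identityˡ m)
  only0orm qm<2m (divides-refl (suc (suc q))) =
    contradiction (*-monoˡ-≤ m (s≤s (s≤s (z≤n {q})))) (<⇒≱ qm<2m)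

foldedOnEdge⇔ : ∀ {m r} → r < 2 * m →
  (r ⊓ (2 * m ∸ r) ≡ 0 ⊎ r ⊓ (2 * m ∸ r) ≡ m) ⇔ (r ≡ 0 ⊎ r ≡ m)
foldedOnEdge⇔ {m} {r} r<2m = mk⇔ unfold fold
  where
  unfold : r ⊓ (2 * m ∸ r) ≡ 0 ⊎ r ⊓ (2 * m ∸ r) ≡ m → r ≡ 0 ⊎ r ≡ m
  unfold with ⊓-sel r (2 * m ∸ r)
  ... | inj₁ ⊓≡r   = Sum.map (trans (sym ⊓≡r)) (trans (sym ⊓≡r))
  ... | inj₂ ⊓≡2m∸r = Sum.[ (λ ⊓≡0 → contradiction (m∸n≡0⇒m≤n (trans (sym ⊓≡2m∸r) ⊓≡0)) (<⇒≱ r<2m))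
                          , (λ ⊓≡m → inj₂ (begin
                              r                   ≡⟨ sym (m∸[m∸n]≡n (<⇒≤ r<2m)) ⟩
                              2 * m ∸ (2 * m ∸ r) ≡⟨ cong (2 * m ∸_) (trans (sym ⊓≡2m∸r) ⊓≡m) ⟩
                              2 * m ∸ m           ≡⟨ [2*m]∸m≡m m ⟩
                              m                   ∎)) ]
  fold : r ≡ 0 ⊎ r ≡ m → r ⊓ (2 * m ∸ r) ≡ 0 ⊎ r ⊓ (2 * m ∸ r) ≡ m
  fold (inj₁ r≡0) = inj₁ (cong (λ t → t ⊓ (2 * m ∸ t)) r≡0)
  fold (inj₂ r≡m) = inj₂ (begin
    r ⊓ (2 * m ∸ r) ≡⟨ cong (λ t → t ⊓ (2 * m ∸ t)) r≡m ⟩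
    m ⊓ (2 * m ∸ m) ≡⟨ cong (m ⊓_) ([2*m]∸m≡m m) ⟩
    m ⊓ m           ≡⟨ ⊓-idem m ⟩
    m               ∎)

φ-onEdge⇔∣ : ∀ m .{{_ : NonZero m}} n → (φ m (ℤ.+ n) ≡ 0 ⊎ φ m (ℤ.+ n) ≡ m) ⇔ m ∣ n
φ-onEdge⇔∣ m@(suc _) n = ∣%⇔∣ ⇔-∘ (⇔-sym (∣⇔≡0⊎≡ r<2m) ⇔-∘ foldedOnEdge⇔ r<2m)
  where
  r<2m : n % (2 * m) < 2 * m
  r<2m = m%n<n n (2 * m)
  ∣%⇔∣ : m ∣ n % (2 * m) ⇔ m ∣ n
  ∣%⇔∣ = mk⇔ (∣n∣m%n⇒∣m (n∣m*n 2)) (λ m∣n → %-presˡ-∣ m∣n (n∣m*n 2))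

𝒦/m₁+𝒦/m₂≡B : ∀ m₁ m₂ .{{_ : NonZero m₁}} .{{_ : NonZero m₂}} →
  𝒦 m₁ m₂ / m₁ + 𝒦 m₁ m₂ / m₂ ≡ B m₁ m₂
𝒦/m₁+𝒦/m₂≡B m₁@(suc _) m₂ = begin
  𝒦 m₁ m₂ / m₁ + 𝒦 m₁ m₂ / m₂       ≡⟨ cong₂ _+_ (/-congˡ 𝒦≡[2*b]*m₁) (/-congˡ 𝒦≡[2*a]*m₂) ⟩
  (2 * b) * m₁ / m₁ + (2 * a) * m₂ / m₂ ≡⟨ cong₂ _+_ (m*n/n≡m (2 * b) m₁) (m*n/n≡m (2 * a) m₂) ⟩
  2 * b + 2 * a                       ≡⟨ sym (m*n/n≡m (2 * b + 2 * a) g) ⟩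
  (2 * b + 2 * a) * g / g             ≡⟨ /-congˡ {o = g} (sym 2[m₁+m₂]≡[2*b+2*a]*g) ⟩
  2 * (m₁ + m₂) / g                   ∎
  where
  g : ℕ
  g = gcd m₁ m₂
  instance
    g≢0 : NonZero g
    g≢0 = ≢-nonZero (gcd[m,n]≢0 m₁ m₂ (inj₁ λ ()))
  a b : ℕ
  a = m₁ / g
  b = m₂ / g
  m₁≡a*g : m₁ ≡ a * g
  m₁≡a*g = sym (m/n*n≡m (gcd[m,n]∣m m₁ m₂))
  m₂≡b*g : m₂ ≡ b * g
  m₂≡b*g = sym (m/n*n≡m (gcd[m,n]∣n m₁ m₂))
  -- 𝒦 m₁ m₂ unfolds to 2 * (m₁ * b), since lcm m₁ m₂ is defined as m₁ * (m₂ / g).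
  𝒦≡[2*b]*m₁ : 2 * (m₁ * b) ≡ (2 * b) * m₁
  𝒦≡[2*b]*m₁ = solve 2 (λ x y → con 2 :* (x :* y) := (con 2 :* y) :* x) refl m₁ b
  𝒦≡[2*a]*m₂ : 2 * (m₁ * b) ≡ (2 * a) * m₂
  𝒦≡[2*a]*m₂ = begin
    2 * (m₁ * b)      ≡⟨ cong (λ t → 2 * (t * b)) m₁≡a*g ⟩
    2 * (a * g * b)   ≡⟨ solve 3 (λ x y z → con 2 :* (x :* y :* z) := (con 2 :* x) :* (z :* y)) refl a g b ⟩
    (2 * a) * (b * g) ≡⟨ cong ((2 * a) *_) (sym m₂≡b*g) ⟩
    (2 * a) * m₂      ∎
  2[m₁+m₂]≡[2*b+2*a]*g : 2 * (m₁ + m₂) ≡ (2 * b + 2 * a) * g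
  2[m₁+m₂]≡[2*b+2*a]*g = begin
    2 * (m₁ + m₂)          ≡⟨ cong₂ (λ u v → 2 * (u + v)) m₁≡a*g m₂≡b*g ⟩
    2 * (a * g + b * g)    ≡⟨ solve 3 (λ x y z → con 2 :* (x :* z :+ y :* z) := (con 2 :* y :+ con 2 :* x) :* z) refl a b g ⟩
    (2 * b + 2 * a) * g    ∎

corollary3p12 : (m₁ m₂ : ℕ) → .{{_ : NonZero m₁}} → .{{_ : NonZero m₂}} →
  (P : Point) → InS m₁ m₂ P →
  ((k : ℤ) → ¬ IsCorner m₁ m₂ (F m₁ m₂ k P)) →
  boundaryCount m₁ m₂ P ≡ B m₁ m₂
corollary3p12 m₁ m₂ P@(x₁ , x₂) _ noCorner = begin
  boundaryCount m₁ m₂ P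
    ≡⟨ length-filter-∪ (λ k → m₁ ∣? x₁ + k) (λ k → m₂ ∣? x₂ + k)
         (λ k → isBoundary? m₁ m₂ (F m₁ m₂ (ℤ.+ k) P)) boundary≐ neverBoth (map suc (upTo K)) ⟩
  countShiftedMultiples m₁ x₁ K + countShiftedMultiples m₂ x₂ K
    ≡⟨ cong₂ _+_ (d∣n⇒countShiftedMultiples≡n/d m₁ x₁ (∣n⇒∣m*n 2 (m∣lcm[m,n] m₁ m₂)))
                 (d∣n⇒countShiftedMultiples≡n/d m₂ x₂ (∣n⇒∣m*n 2 (n∣lcm[m,n] m₁ m₂))) ⟩
  K / m₁ + K / m₂
    ≡⟨ 𝒦/m₁+𝒦/m₂≡B m₁ m₂ ⟩
  B m₁ m₂ ∎
  where
  K : ℕ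
  K = 𝒦 m₁ m₂
  boundary≐ : (λ k → IsBoundary m₁ m₂ (F m₁ m₂ (ℤ.+ k) P)) ≐ ((λ k → m₁ ∣ x₁ + k) ∪ (λ k → m₂ ∣ x₂ + k))
  boundary≐ = (λ {k} → Sum.map (to (φ-onEdge⇔∣ m₁ (x₁ + k))) (to (φ-onEdge⇔∣ m₂ (x₂ + k))))
            , (λ {k} → Sum.map (from (φ-onEdge⇔∣ m₁ (x₁ + k))) (from (φ-onEdge⇔∣ m₂ (x₂ + k))))
  neverBoth : Empty ((λ k → m₁ ∣ x₁ + k) ∩ (λ k → m₂ ∣ x₂ + k))
  neverBoth k (d₁ , d₂) = noCorner (ℤ.+ k) (from (φ-onEdge⇔∣ m₁ (x₁ + k)) d₁ , from (φ-onEdge⇔∣ m₂ (x₂ + k)) d₂)
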